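{- Let $L$ be an intermediate logic with the disjunction property, let $r=\Gamma/\Delta$ be an m-rule, and let $q$ be a propositional variable not occurring in $r$. Then $r$ is admissible for $L$ if and only if the rule $r^q=\bigwedge_{A\in\Gamma}A\lor q\,/\,\bigvee_{B\in\Delta}B\lor q$ is admissible for $L$.
   Context: Formulas are built from a countable set of propositional variables using $\land,\lor,\to,\neg,\bot,\top$; an empty conjunction is $\top$ and an empty disjunction is $\bot$. An intermediate logic is a set $L$ of formulas with $\mathrm{Int}\subseteq L\subsetneq$ (all formulas), closed under modus ponens (and substitution), where $\mathrm{Int}$ is intuitionistic propositional logic. $L$ has the disjunction property if $A\lor B\in L$ implies $A\in L$ or $B\in L$. An m-rule is a pair of finite sets of formulas $\Gamma,\Delta$, written $\Gamma/\Delta$; a rule has one conclusion. An m-rule $\Gamma/\Delta$ is admissible for $L$ if for every substitution $\sigma$, $\sigma(\Gamma)\subseteq L$ implies $\sigma(\Delta)\cap L\ne\emptyset$. -}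

module Defs where

open import Data.Nat using (ℕ)
open import Data.List using (List; []; _∷_)
open import Data.List.Membership.Propositional using (_∈_)
open import Data.List.Relation.Unary.Any using (Any)
open import Data.Product using (Σ; ∃; _×_; _,_)
open import Relation.Nullary using (¬_)
open import Data.Sum using (_⊎_)

infixr 6 _∧_
infixr 5 _∨_
infixr 4 _⇒_

data Formula : Set where
  var  : ℕ → Formula
  _∧_  : Formula → Formula → Formula
  _∨_  : Formula → Formula → Formula
  _⇒_  : Formula → Formula → Formula
  ¬'   : Formula → Formula
  ⊥'   : Formula
  ⊤'   : Formula

Subst : Set
Subst = ℕ → Formula

sub : Subst → Formula → Formula
sub σ (var n) = σ n
sub σ (A ∧ B) = sub σ A ∧ sub σ B
sub σ (A ∨ B) = sub σ A ∨ sub σ B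
sub σ (A ⇒ B) = sub σ A ⇒ sub σ B
sub σ (¬' A)  = ¬' (sub σ A)
sub σ ⊥'      = ⊥'
sub σ ⊤'      = ⊤'

data Occurs (q : ℕ) : Formula → Set where
  here : Occurs q (var q)
  ∧l : ∀ {A B} → Occurs q A → Occurs q (A ∧ B)
  ∧r : ∀ {A B} → Occurs q B → Occurs q (A ∧ B)
  ∨l : ∀ {A B} → Occurs q A → Occurs q (A ∨ B)
  ∨r : ∀ {A B} → Occurs q B → Occurs q (A ∨ B)
  ⇒l : ∀ {A B} → Occurs q A → Occurs q (A ⇒ B)
  ⇒r : ∀ {A B} → Occurs q B → Occurs q (A ⇒ B)
  ¬o : ∀ {A} → Occurs q A → Occurs q (¬' A)

data Int : Formula → Set where
  k    : ∀ A B → Int (A ⇒ B ⇒ A)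
  s    : ∀ A B C → Int ((A ⇒ B ⇒ C) ⇒ (A ⇒ B) ⇒ A ⇒ C)
  ∧e₁  : ∀ A B → Int (A ∧ B ⇒ A)
  ∧e₂  : ∀ A B → Int (A ∧ B ⇒ B)
  ∧i   : ∀ A B → Int (A ⇒ B ⇒ A ∧ B)
  ∨i₁  : ∀ A B → Int (A ⇒ A ∨ B)
  ∨i₂  : ∀ A B → Int (B ⇒ A ∨ B)
  ∨e   : ∀ A B C → Int ((A ⇒ C) ⇒ (B ⇒ C) ⇒ A ∨ B ⇒ C)
  efq  : ∀ A → Int (⊥' ⇒ A)
  top  : Int ⊤'
  ¬e   : ∀ A → Int (¬' A ⇒ A ⇒ ⊥')
  ¬i   : ∀ A → Int ((A ⇒ ⊥') ⇒ ¬' A)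
  mp   : ∀ {A B} → Int (A ⇒ B) → Int A → Int B

Logic : Set₁
Logic = Formula → Set

record IsIntermediate (L : Logic) : Set where
  field
    includesInt : ∀ A → Int A → L A
    consistent  : Σ Formula (λ A → ¬ L A)
    closedMP    : ∀ A B → L (A ⇒ B) → L A → L B
    closedSub   : ∀ (σ : Subst) A → L A → L (sub σ A)

DisjunctionProperty : Logic → Set
DisjunctionProperty L = ∀ A B → L (A ∨ B) → L A ⊎ L B

-- m-rules Γ / Δ with finite sets represented as lists.
record MRule : Set where
  constructor _/_
  field
    prem : List Formula
    conc : List Formula

open MRule public

Admissible : Logic → MRule → Set
Admissible L (Γ / Δ) =
  ∀ (σ : Subst) → (∀ A → A ∈ Γ → L (sub σ A)) → Any (λ B → L (sub σ B)) Δ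

⋀ : List Formula → Formula
⋀ []       = ⊤'
⋀ (A ∷ []) = A
⋀ (A ∷ Γ)  = A ∧ ⋀ Γ

⋁ : List Formula → Formula
⋁ []       = ⊥'
⋁ (A ∷ []) = A
⋁ (A ∷ Δ)  = A ∨ ⋁ Δ

OccursIn : ℕ → MRule → Set
OccursIn q (Γ / Δ) = Any (Occurs q) Γ ⊎ Any (Occurs q) Δ

_^_ : MRule → ℕ → MRule
(Γ / Δ) ^ q = ((⋀ Γ ∨ var q) ∷ []) / ((⋁ Δ ∨ var q) ∷ [])

-- Under the disjunction property an m-rule Γ / Δ is admissible exactly when the
-- single rule ⋀Γ / ⋁Δ is, so it suffices to compare A / B with A ∨ q / B ∨ q for
-- q fresh.  If A / B is admissible, a substitution instance of A ∨ q splits by the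
-- disjunction property and either disjunct yields B ∨ q.  Conversely, given σ(A),
-- substitute ⊥ for q: freshness leaves σ(A) and σ(B) unchanged, the rule gives
-- σ(B) ∨ ⊥, and consistency rules out the right disjunct.
module Submission where

open import Defs
open import Data.Nat using (ℕ; _≟_)
open import Data.Nat.Properties using (≟-diag)
open import Data.List using ([]; _∷_)
open import Data.List.Membership.Propositional using (_∈_)
open import Data.List.Relation.Unary.Any using (Any; here; there)
open import Data.Product using (_,_)
open import Data.Sum using (inj₁; inj₂; [_,_]′)
open import Data.Empty using (⊥-elim)
open import Function.Base using (_∘_)
open import Function.Bundles using (_⇔_; mk⇔)
open import Function.Construct.Composition using (_⇔-∘_)
open import Function.Construct.Symmetry using (⇔-sym)
open import Relation.Nullary using (¬_; yes; no)
open import Relation.Binary.PropositionalEquality using (_≡_; refl; cong; cong₂; subst; sym)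

_[_≔_] : Subst → ℕ → Formula → Subst
(σ [ q ≔ B ]) n with n ≟ q
... | yes _ = B
... | no _  = σ n

[≔]-same : ∀ σ q B → (σ [ q ≔ B ]) q ≡ B
[≔]-same σ q B rewrite ≟-diag {q} refl = refl

sub-[≔]-fresh : ∀ σ {q} B A → ¬ Occurs q A → sub (σ [ q ≔ B ]) A ≡ sub σ A
sub-[≔]-fresh σ {q} B (var n) q∉A with n ≟ q
... | yes refl = ⊥-elim (q∉A here)
... | no _     = refl
sub-[≔]-fresh σ B (A₁ ∧ A₂) q∉A =
  cong₂ _∧_ (sub-[≔]-fresh σ B A₁ (q∉A ∘ ∧l)) (sub-[≔]-fresh σ B A₂ (q∉A ∘ ∧r))
sub-[≔]-fresh σ B (A₁ ∨ A₂) q∉A =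
  cong₂ _∨_ (sub-[≔]-fresh σ B A₁ (q∉A ∘ ∨l)) (sub-[≔]-fresh σ B A₂ (q∉A ∘ ∨r))
sub-[≔]-fresh σ B (A₁ ⇒ A₂) q∉A =
  cong₂ _⇒_ (sub-[≔]-fresh σ B A₁ (q∉A ∘ ⇒l)) (sub-[≔]-fresh σ B A₂ (q∉A ∘ ⇒r))
sub-[≔]-fresh σ B (¬' A) q∉A = cong ¬' (sub-[≔]-fresh σ B A (q∉A ∘ ¬o))
sub-[≔]-fresh σ B ⊥' _ = refl
sub-[≔]-fresh σ B ⊤' _ = refl

occurs-⋀ : ∀ {q} Γ → Occurs q (⋀ Γ) → Any (Occurs q) Γ
occurs-⋀ (A ∷ [])    o      = here o
occurs-⋀ (A ∷ _ ∷ _) (∧l o) = here o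
occurs-⋀ (A ∷ B ∷ Γ) (∧r o) = there (occurs-⋀ (B ∷ Γ) o)

occurs-⋁ : ∀ {q} Δ → Occurs q (⋁ Δ) → Any (Occurs q) Δ
occurs-⋁ (A ∷ [])    o      = here o
occurs-⋁ (A ∷ _ ∷ _) (∨l o) = here o
occurs-⋁ (A ∷ B ∷ Δ) (∨r o) = there (occurs-⋁ (B ∷ Δ) o)

AdmissibleRule : Logic → Formula → Formula → Set
AdmissibleRule L A B = ∀ σ → L (sub σ A) → L (sub σ B)

Admissible-single⇔ : ∀ L A B → Admissible L ((A ∷ []) / (B ∷ [])) ⇔ AdmissibleRule L A B
Admissible-single⇔ L A B = mk⇔ to from
  where
  to : Admissible L ((A ∷ []) / (B ∷ [])) → AdmissibleRule L A B
  to adm σ a with adm σ (λ { _ (here refl) → a })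
  ... | here b = b

  from : AdmissibleRule L A B → Admissible L ((A ∷ []) / (B ∷ []))
  from rule σ prems = here (rule σ (prems A (here refl)))

module _ {L : Logic} (L-int : IsIntermediate L) where
  open IsIntermediate L-int

  mp-Int : ∀ {A B} → Int (A ⇒ B) → L A → L B
  mp-Int ⊢A⇒B = closedMP _ _ (includesInt _ ⊢A⇒B)

  ⊥∉L : ¬ L ⊥'
  ⊥∉L ⊥∈L with consistent
  ... | A , A∉L = A∉L (mp-Int (efq A) ⊥∈L)

  ⋀-intro : ∀ σ Γ → (∀ A → A ∈ Γ → L (sub σ A)) → L (sub σ (⋀ Γ))
  ⋀-intro σ []          _  = includesInt ⊤' top
  ⋀-intro σ (A ∷ [])    ps = ps A (here refl)
  ⋀-intro σ (A ∷ B ∷ Γ) ps =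
    closedMP _ _ (mp-Int (∧i _ _) (ps A (here refl)))
                 (⋀-intro σ (B ∷ Γ) λ C → ps C ∘ there)

  ⋀-elim : ∀ σ Γ → L (sub σ (⋀ Γ)) → ∀ A → A ∈ Γ → L (sub σ A)
  ⋀-elim σ (A ∷ [])    p _ (here refl) = p
  ⋀-elim σ (A ∷ _ ∷ _) p _ (here refl) = mp-Int (∧e₁ _ _) p
  ⋀-elim σ (A ∷ B ∷ Γ) p C (there C∈Γ) = ⋀-elim σ (B ∷ Γ) (mp-Int (∧e₂ _ _) p) C C∈Γ

  ⋁-intro : ∀ σ Δ → Any (λ B → L (sub σ B)) Δ → L (sub σ (⋁ Δ))
  ⋁-intro σ (A ∷ [])    (here p)  = p
  ⋁-intro σ (A ∷ _ ∷ _) (here p)  = mp-Int (∨i₁ _ _) p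
  ⋁-intro σ (A ∷ B ∷ Δ) (there p) = mp-Int (∨i₂ _ _) (⋁-intro σ (B ∷ Δ) p)

  module _ (dp : DisjunctionProperty L) where

    ⋁-elim : ∀ σ Δ → L (sub σ (⋁ Δ)) → Any (λ B → L (sub σ B)) Δ
    ⋁-elim σ []          p = ⊥-elim (⊥∉L p)
    ⋁-elim σ (A ∷ [])    p = here p
    ⋁-elim σ (A ∷ B ∷ Δ) p = [ here , there ∘ ⋁-elim σ (B ∷ Δ) ]′ (dp _ _ p)

    Admissible⇔⋀⋁ : ∀ Γ Δ → Admissible L (Γ / Δ) ⇔ AdmissibleRule L (⋀ Γ) (⋁ Δ)
    Admissible⇔⋀⋁ Γ Δ = mk⇔
      (λ adm σ p → ⋁-intro σ Δ (adm σ (⋀-elim σ Γ p)))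
      (λ rule σ ps → ⋁-elim σ Δ (rule σ (⋀-intro σ Γ ps)))

    AdmissibleRule⇔∨-fresh : ∀ A B q → ¬ Occurs q A → ¬ Occurs q B →
      AdmissibleRule L A B ⇔ AdmissibleRule L (A ∨ var q) (B ∨ var q)
    AdmissibleRule⇔∨-fresh A B q q∉A q∉B = mk⇔ to from
      where
      to : AdmissibleRule L A B → AdmissibleRule L (A ∨ var q) (B ∨ var q)
      to rule σ p = [ mp-Int (∨i₁ _ _) ∘ rule σ , mp-Int (∨i₂ _ _) ]′ (dp _ _ p)

      from : AdmissibleRule L (A ∨ var q) (B ∨ var q) → AdmissibleRule L A B
      from rule σ a =
        [ subst L (sub-[≔]-fresh σ ⊥' B q∉B) , ⊥-elim ∘ ⊥∉L ∘ subst L ([≔]-same σ q ⊥') ]′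
          (dp _ _ (rule τ (mp-Int (∨i₁ _ _) aτ)))
        where
        τ : Subst
        τ = σ [ q ≔ ⊥' ]

        aτ : L (sub τ A)
        aτ = subst L (sym (sub-[≔]-fresh σ ⊥' A q∉A)) a

mainTheorem5 : (L : Logic) → IsIntermediate L → DisjunctionProperty L →
    (r : MRule) → (q : ℕ) → ¬ OccursIn q r →
    Admissible L r ⇔ Admissible L (r ^ q)
mainTheorem5 L L-int dp (Γ / Δ) q q∉r =
  ⇔-sym single-rule ⇔-∘ (add-fresh-disjunct ⇔-∘ collapse)
  where
  collapse : Admissible L (Γ / Δ) ⇔ AdmissibleRule L (⋀ Γ) (⋁ Δ)
  collapse = Admissible⇔⋀⋁ L-int dp Γ Δ

  add-fresh-disjunct : AdmissibleRule L (⋀ Γ) (⋁ Δ) ⇔ AdmissibleRule L (⋀ Γ ∨ var q) (⋁ Δ ∨ var q)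
  add-fresh-disjunct = AdmissibleRule⇔∨-fresh L-int dp (⋀ Γ) (⋁ Δ) q
    (q∉r ∘ inj₁ ∘ occurs-⋀ Γ) (q∉r ∘ inj₂ ∘ occurs-⋁ Δ)

  single-rule : Admissible L ((Γ / Δ) ^ q) ⇔ AdmissibleRule L (⋀ Γ ∨ var q) (⋁ Δ ∨ var q)
  single-rule = Admissible-single⇔ L (⋀ Γ ∨ var q) (⋁ Δ ∨ var q)
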